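{- For every polynomial $q(n_1,\dots,n_k)$ with integer coefficients there is a function definition $f$ with $k$ list parameters in the language which is total and shapely and whose size dependency is $q^2$: for every heap and all argument values representing lists of lengths $n_1,\dots,n_k$, the evaluation of $f$ on these arguments terminates and yields a list of length $q(n_1,\dots,n_k)^2$.
   Context: The language: expressions built from integer constants, integer operations $x\,\mathsf{binop}\,y$ ($+,-,\mathsf{div},\mathsf{mod}$), $\mathsf{nil}$, $\mathsf{cons}(z,l)$, function calls $f(z_1,\dots,z_n)$ on variables, $\mathsf{let}\ z=b\ \mathsf{in}\ e$ (with $b$ a basic expression of the preceding forms), $\mathsf{if}\ x\ \mathsf{then}\ e_1\ \mathsf{else}\ e_2$ (true iff $x\neq0$), $\mathsf{match}\ l\ \mathsf{with}\ \mathsf{nil}\Rightarrow e_1\mid\mathsf{cons}(hd,tl)\Rightarrow e_2$, and (possibly recursive) function definitions $\mathsf{letfun}\ f(z_1,\dots,z_n)=e_1\ \mathsf{in}\ e_2$ whose bodies have free variables among their parameters; evaluation is the standard strict call-by-value semantics on a heap of cons-cells (each cell at a location $\ell$ holds a $\mathtt{hd}$ value and a $\mathtt{tl}$ value; $\mathsf{nil}$ is the value $\mathtt{NULL}$; $\mathsf{cons}$ allocates a fresh cell). A value $v$ represents a list of length $n$ in heap $h$ if $n=0$ and $v=\mathtt{NULL}$, or $n\ge1$, $v=\ell\in\mathrm{dom}\,h$ and $h.\ell.\mathtt{tl}$ represents a list of length $n-1$ in $h$ with $\ell$ removed. A function definition is total if its evaluation terminates on all arguments representing lists; it is shapely with size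 dependency $p$ if on arguments of lengths $n_1,\dots,n_k$ its result is always a list of length $p(n_1,\dots,n_k)$. -}

module Defs where

open import Data.Nat as ℕ using (ℕ; zero; suc; _≤_)
open import Data.Integer as ℤ using (ℤ; +_; -[1+_]; ∣_∣)
open import Data.Integer.DivMod using (_/_; _%_)
open import Data.Fin using (Fin)
open import Data.Vec as Vec using (Vec; []; _∷_)
open import Data.List using (List; []; _∷_)
open import Data.List.Membership.Propositional using (_∈_)
open import Data.List.Relation.Unary.All using (All)
open import Data.List.Relation.Unary.Unique.Propositional using (Unique)
open import Data.Maybe using (Maybe; just; nothing)
open import Data.Product using (Σ; _×_; _,_; ∃₂)
open import Data.Unit using (⊤)
open import Relation.Binary.PropositionalEquality using (_≡_; _≢_)
open import Relation.Nullary using (yes; no)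

Var : Set
Var = ℕ

FName : Set
FName = ℕ

data Op : Set where
  plus minus div mod : Op

data Basic : Set where
  bconst : ℤ → Basic
  bop    : Op → Var → Var → Basic
  bnil   : Basic
  bcons  : Var → Var → Basic
  bcall  : FName → List Var → Basic

data Expr : Set where
  basic   : Basic → Expr
  elet    : Var → Basic → Expr → Expr
  eif     : Var → Expr → Expr → Expr
  ematch  : Var → Expr → Var → Var → Expr → Expr      -- match l with nil ⇒ e1 | cons(hd,tl) ⇒ e2
  eletfun : FName → List Var → Expr → Expr → Expr     -- letfun f(z1..zn) = e1 in e2

WFB : List Var → Basic → Set
WFB S (bconst _)  = ⊤
WFB S (bop _ x y) = (x ∈ S) × (y ∈ S)
WFB S bnil        = ⊤
WFB S (bcons z l) = (z ∈ S) × (l ∈ S)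
WFB S (bcall _ zs) = All (_∈ S) zs

WF : List Var → Expr → Set
WF S (basic b)             = WFB S b
WF S (elet z b e)          = WFB S b × WF (z ∷ S) e
WF S (eif x e₁ e₂)         = (x ∈ S) × WF S e₁ × WF S e₂
WF S (ematch l e₁ hd tl e₂) = (l ∈ S) × WF S e₁ × WF (hd ∷ tl ∷ S) e₂
WF S (eletfun f ps e₁ e₂)  = WF ps e₁ × WF S e₂

Loc : Set
Loc = ℕ

data Val : Set where
  vint  : ℤ → Val
  vnull : Val
  vloc  : Loc → Val

record Cell : Set where
  constructor cell
  field
    hd : Val
    tl : Val

Heap : Set
Heap = Loc → Maybe Cell

FiniteHeap : Heap → Set
FiniteHeap h = Σ ℕ λ b → (ℓ : Loc) → b ≤ ℓ → h ℓ ≡ nothing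

Env : Set
Env = Var → Maybe Val

emptyEnv : Env
emptyEnv _ = nothing

_[_↦_] : {A : Set} → (ℕ → Maybe A) → ℕ → A → (ℕ → Maybe A)
(g [ x ↦ a ]) y with x ℕ.≟ y
... | yes _ = just a
... | no  _ = g y

remove : Loc → Heap → Heap
remove ℓ h ℓ' with ℓ ℕ.≟ ℓ'
... | yes _ = nothing
... | no  _ = h ℓ'

-- closures: name, parameters, body, function environment at definition
data Closure : Set where
  clo : FName → List Var → Expr → (FName → Maybe Closure) → Closure

FunEnv : Set
FunEnv = FName → Maybe Closure

emptyFunEnv : FunEnv
emptyFunEnv _ = nothing

lookupArgs : Env → List Var → Maybe (List Val)
lookupArgs E [] = just []
lookupArgs E (z ∷ zs) with E z | lookupArgs E zs
... | just v | just vs = just (v ∷ vs)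
... | _      | _       = nothing

bindArgs : List Var → List Val → Maybe Env
bindArgs [] [] = just emptyEnv
bindArgs (p ∷ ps) (v ∷ vs) with bindArgs ps vs
... | just E  = just (E [ p ↦ v ])
... | nothing = nothing
bindArgs _ _ = nothing

-- integer operations; div/mod by zero is undefined (evaluation gets stuck)
opSem : Op → ℤ → ℤ → Maybe ℤ
opSem plus  a b = just (a ℤ.+ b)
opSem minus a b = just (a ℤ.- b)
opSem div   a (+ zero)    = nothing
opSem div   a (+ suc n)   = just (a / + suc n)
opSem div   a -[1+ n ]    = just (a / -[1+ n ])
opSem mod   a (+ zero)    = nothing
opSem mod   a (+ suc n)   = just (+ (a % + suc n))
opSem mod   a -[1+ n ]    = just (+ (a % -[1+ n ]))

data EvalB : FunEnv → Env → Heap → Basic → Val → Heap → Set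
data Eval  : FunEnv → Env → Heap → Expr  → Val → Heap → Set

data EvalB where
  e-const : ∀ {F E h n} → EvalB F E h (bconst n) (vint n) h
  e-op    : ∀ {F E h o x y a b c} → E x ≡ just (vint a) → E y ≡ just (vint b) →
            opSem o a b ≡ just c → EvalB F E h (bop o x y) (vint c) h
  e-nil   : ∀ {F E h} → EvalB F E h bnil vnull h
  e-cons  : ∀ {F E h z l v₁ v₂} (ℓ : Loc) → E z ≡ just v₁ → E l ≡ just v₂ →
            h ℓ ≡ nothing →
            EvalB F E h (bcons z l) (vloc ℓ) (h [ ℓ ↦ cell v₁ v₂ ])
  e-call  : ∀ {F E h h' f zs g ps body D vs E' v} →
            F f ≡ just (clo g ps body D) →
            lookupArgs E zs ≡ just vs →
            bindArgs ps vs ≡ just E' →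
            Eval (D [ g ↦ clo g ps body D ]) E' h body v h' →
            EvalB F E h (bcall f zs) v h'

data Eval where
  e-basic : ∀ {F E h b v h'} → EvalB F E h b v h' → Eval F E h (basic b) v h'
  e-let   : ∀ {F E h z b e v₁ h₁ v h'} → EvalB F E h b v₁ h₁ →
            Eval F (E [ z ↦ v₁ ]) h₁ e v h' → Eval F E h (elet z b e) v h'
  e-ifT   : ∀ {F E h x n e₁ e₂ v h'} → E x ≡ just (vint n) → n ≢ + 0 →
            Eval F E h e₁ v h' → Eval F E h (eif x e₁ e₂) v h'
  e-ifF   : ∀ {F E h x e₁ e₂ v h'} → E x ≡ just (vint (+ 0)) →
            Eval F E h e₂ v h' → Eval F E h (eif x e₁ e₂) v h'
  e-matchN : ∀ {F E h l e₁ hd tl e₂ v h'} → E l ≡ just vnull →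
             Eval F E h e₁ v h' → Eval F E h (ematch l e₁ hd tl e₂) v h'
  e-matchC : ∀ {F E h l e₁ hd tl e₂ v h' ℓ a b} → E l ≡ just (vloc ℓ) →
             h ℓ ≡ just (cell a b) →
             Eval F ((E [ hd ↦ a ]) [ tl ↦ b ]) h e₂ v h' →
             Eval F E h (ematch l e₁ hd tl e₂) v h'
  e-letfun : ∀ {F E h f ps e₁ e₂ v h'} →
             Eval (F [ f ↦ clo f ps e₁ F ]) E h e₂ v h' →
             Eval F E h (eletfun f ps e₁ e₂) v h'

data Represents : Heap → Val → ℕ → Set where
  rep-nil  : ∀ {h} → Represents h vnull 0
  rep-cons : ∀ {h ℓ c n} → h ℓ ≡ just c →
             Represents (remove ℓ h) (Cell.tl c) n →
             Represents h (vloc ℓ) (suc n)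

record FunDef (k : ℕ) : Set where
  constructor fundef
  field
    name   : FName
    params : Vec Var k
    body   : Expr

open FunDef public

WellFormedDef : ∀ {k} → FunDef k → Set
WellFormedDef fd = Unique (Vec.toList (params fd)) × WF (Vec.toList (params fd)) (body fd)

bindVec : ∀ {k} → Vec Var k → Vec Val k → Env
bindVec [] [] = emptyEnv
bindVec (p ∷ ps) (v ∷ vs) = bindVec ps vs [ p ↦ v ]

RunsTo : ∀ {k} → FunDef k → Vec Val k → Heap → Val → Heap → Set
RunsTo fd vs h v h' =
  Eval (emptyFunEnv [ name fd ↦ clo (name fd) (Vec.toList (params fd)) (body fd) emptyFunEnv ])
       (bindVec (params fd) vs) h (body fd) v h'

ArgsRepresent : ∀ {k} → Heap → Vec Val k → Vec ℕ k → Set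
ArgsRepresent h vs ns = (i : Fin _) → Represents h (Vec.lookup vs i) (Vec.lookup ns i)

Total : ∀ {k} → FunDef k → Set
Total {k} fd = (h : Heap) → FiniteHeap h → (vs : Vec Val k) (ns : Vec ℕ k) →
  ArgsRepresent h vs ns → ∃₂ λ v h' → RunsTo fd vs h v h'

ShapelyWith : ∀ {k} → FunDef k → (Vec ℕ k → ℕ) → Set
ShapelyWith {k} fd p = (h : Heap) → FiniteHeap h → (vs : Vec Val k) (ns : Vec ℕ k) →
  ArgsRepresent h vs ns → ∀ v h' → RunsTo fd vs h v h' → Represents h' v (p ns)

data Poly (k : ℕ) : Set where
  pconst : ℤ → Poly k
  pvar   : Fin k → Poly k
  padd   : Poly k → Poly k → Poly k
  pmul   : Poly k → Poly k → Poly k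

⟦_⟧ : ∀ {k} → Poly k → Vec ℕ k → ℤ
⟦ pconst c ⟧ ns = c
⟦ pvar i ⟧ ns = + Vec.lookup ns i
⟦ padd p q ⟧ ns = ⟦ p ⟧ ns ℤ.+ ⟦ q ⟧ ns
⟦ pmul p q ⟧ ns = ⟦ p ⟧ ns ℤ.* ⟦ q ⟧ ns

sq : ∀ {k} → Poly k → Vec ℕ k → ℕ
sq q ns = ∣ ⟦ q ⟧ ns ℤ.* ⟦ q ⟧ ns ∣

module Submission where

-- The witness is the program
--   f(l₀, …, l_{k-1}) = letfun len, aux, mul, build in
--                       ⟨evaluate q into variable k⟩; build(mul(v_k, v_k))
-- where len computes the length of a list, mul multiplies two integers by
-- counting (its loop aux searches for the multiplier upwards and downwards
-- at the same time, since it may be negative), and build(w) allocates a list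
-- of length w for w ≥ 0.  The polynomial is compiled by comp into a chain of
-- let-bindings that uses fresh scratch variables above the parameters.
--
-- The central fact about the compiler is that
-- comp q m K behaves exactly like K started in the explicitly described
-- environment result q ns m E (comp-correct and comp-complete).

open import Defs
open import Data.Nat as ℕ using (ℕ; zero; suc; _≤_; _<_; s≤s)
import Data.Nat.Properties as ℕP
open import Data.Integer as ℤ using (ℤ; +_; -[1+_]; ∣_∣)
import Data.Integer.Properties as ℤP
open import Data.Integer.Tactic.RingSolver using (solve-∀)
open import Data.Fin as Fin using (Fin; toℕ)
open import Data.Fin.Properties using (toℕ<n)
open import Data.Vec as Vec using (Vec; []; _∷_)
open import Data.List using (List; []; _∷_)
open import Data.List.Membership.Propositional using (_∈_)
open import Data.List.Membership.DecPropositional ℕ._≟_ using (_∈?_)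
open import Data.List.Relation.Unary.Any using (here; there)
open import Data.List.Relation.Unary.All as All using (All; []; _∷_; all?)
open import Data.List.Relation.Unary.AllPairs using ([]; _∷_)
open import Data.List.Relation.Unary.Unique.Propositional using (Unique)
open import Data.List.Relation.Binary.Subset.Propositional using (_⊆_)
open import Data.List.Relation.Binary.Subset.Propositional.Properties using (∷⁺ʳ)
open import Data.Maybe using (Maybe; just; nothing)
open import Data.Product using (Σ; _×_; _,_; ∃₂)
open import Data.Sum using (_⊎_; inj₁; inj₂; [_,_]′)
open import Data.Unit using (tt)
open import Data.Empty using (⊥-elim)
open import Relation.Binary.PropositionalEquality
open import Relation.Nullary using (yes; no; Dec)
open import Relation.Nullary.Decidable using (_×-dec_; toWitness)

update-same : ∀ {A : Set} (g : ℕ → Maybe A) x a → (g [ x ↦ a ]) x ≡ just a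
update-same g x a with x ℕ.≟ x
... | yes _    = refl
... | no  x≢x = ⊥-elim (x≢x refl)

update-other : ∀ {A : Set} (g : ℕ → Maybe A) {x y} a → x ≢ y → (g [ x ↦ a ]) y ≡ g y
update-other g {x} {y} a x≢y with x ℕ.≟ y
... | yes x≡y = ⊥-elim (x≢y x≡y)
... | no  _   = refl

vint-injective : ∀ {a b} → just (vint a) ≡ just (vint b) → a ≡ b
vint-injective refl = refl

-- Unlike
-- Represents this does not require the cells to be distinct and is stable
-- under heap growth; it is exactly what the length function needs.
data Walk (h : Heap) : Val → ℕ → Set where
  walk-nil  : Walk h vnull 0
  walk-cons : ∀ {ℓ c n} → h ℓ ≡ just c → Walk h (Cell.tl c) n → Walk h (vloc ℓ) (suc n)

_⊑_ : Heap → Heap → Set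
h′ ⊑ h = ∀ ℓ {c} → h′ ℓ ≡ just c → h ℓ ≡ just c

remove-⊑ : ∀ ℓ h → remove ℓ h ⊑ h
remove-⊑ ℓ h ℓ′ found with ℓ ℕ.≟ ℓ′ | found
... | yes _ | ()
... | no  _ | kept = kept

represents⇒walk : ∀ {h′ h v n} → h′ ⊑ h → Represents h′ v n → Walk h v n
represents⇒walk h′⊑h rep-nil = walk-nil
represents⇒walk {h′} h′⊑h (rep-cons {ℓ = ℓ} stored rest) =
  walk-cons (h′⊑h ℓ stored) (represents⇒walk (λ ℓ′ c → h′⊑h ℓ′ (remove-⊑ ℓ h′ ℓ′ c)) rest)

represents-ext : ∀ {h h′ v n} → (∀ ℓ → h ℓ ≡ h′ ℓ) → Represents h v n → Represents h′ v n
represents-ext h≗h′ rep-nil = rep-nil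
represents-ext {h} {h′} h≗h′ (rep-cons {ℓ = ℓ} stored rest) =
  rep-cons (trans (sym (h≗h′ ℓ)) stored) (represents-ext removed≗ rest)
  where
  removed≗ : ∀ ℓ′ → remove ℓ h ℓ′ ≡ remove ℓ h′ ℓ′
  removed≗ ℓ′ with ℓ ℕ.≟ ℓ′
  ... | yes _ = refl
  ... | no  _ = h≗h′ ℓ′

remove-fresh : ∀ {h : Heap} {ℓ} c → h ℓ ≡ nothing → ∀ ℓ′ → h ℓ′ ≡ remove ℓ (h [ ℓ ↦ c ]) ℓ′
remove-fresh {h} {ℓ} c fresh ℓ′ with ℓ ℕ.≟ ℓ′
... | yes refl = fresh
... | no  ℓ≢ℓ′ = sym (update-other h c ℓ≢ℓ′)

represents-push : ∀ {h v n ℓ} a → h ℓ ≡ nothing → Represents h v n →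
  Represents (h [ ℓ ↦ cell a v ]) (vloc ℓ) (suc n)
represents-push {h} {ℓ = ℓ} a fresh rest =
  rep-cons (update-same h ℓ _) (represents-ext (remove-fresh _ fresh) rest)

allocate-finite : ∀ (h : Heap) b c → (∀ ℓ → b ≤ ℓ → h ℓ ≡ nothing) → FiniteHeap (h [ b ↦ c ])
allocate-finite h b c above = suc b , λ ℓ b<ℓ →
  trans (update-other h c (λ b≡ℓ → ℕP.<-irrefl b≡ℓ b<ℓ)) (above ℓ (ℕP.<⇒≤ b<ℓ))

lookup-one : ∀ (E : Env) z {v} → E z ≡ just v → lookupArgs E (z ∷ []) ≡ just (v ∷ [])
lookup-one E z found rewrite found = refl

lookup-two : ∀ (E : Env) z₁ z₂ {v₁ v₂} → E z₁ ≡ just v₁ → E z₂ ≡ just v₂ →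
  lookupArgs E (z₁ ∷ z₂ ∷ []) ≡ just (v₁ ∷ v₂ ∷ [])
lookup-two E z₁ z₂ found₁ found₂ rewrite found₁ | found₂ = refl

call-inv : ∀ {F E h f zs g ps body D vs E′ r h′} → F f ≡ just (clo g ps body D) →
  lookupArgs E zs ≡ just vs → bindArgs ps vs ≡ just E′ → EvalB F E h (bcall f zs) r h′ →
  Eval (D [ g ↦ clo g ps body D ]) E′ h body r h′
call-inv isClo args binds (e-call isClo′ args′ binds′ run)
  with trans (sym isClo) isClo′ | trans (sym args) args′
... | refl | refl with trans (sym binds) binds′
... | refl = run

-- len(l) = match l with nil ⇒ 0 | cons(_, t) ⇒ len(t) + 1      (function 1)

lenBody : Expr
lenBody = ematch 0 (basic (bconst (+ 0))) 1 2
  (elet 3 (bcall 1 (2 ∷ [])) (elet 4 (bconst (+ 1)) (basic (bop plus 3 4))))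

lenClosure : FunEnv → Closure
lenClosure D = clo 1 (0 ∷ []) lenBody D

succ-ℤ : ∀ n → + n ℤ.+ + 1 ≡ + suc n
succ-ℤ n = ℤP.+-comm (+ n) (+ 1)

len-correct : ∀ {D h v n r h′} → Walk h v n →
  Eval (D [ 1 ↦ lenClosure D ]) (emptyEnv [ 0 ↦ v ]) h lenBody r h′ → r ≡ vint (+ n) × h′ ≡ h
len-correct walk-nil (e-matchN refl (e-basic e-const)) = refl , refl
len-correct walk-nil (e-matchC () _ _)
len-correct (walk-cons _ _) (e-matchN () _)
len-correct (walk-cons stored rest) (e-matchC refl stored′
  (e-let (e-call refl refl refl run) (e-let e-const (e-basic (e-op refl refl refl)))))
  with trans (sym stored) stored′
... | refl with len-correct rest run
... | refl , refl = cong vint (succ-ℤ _) , refl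

len-terminates : ∀ {D h v n} → Walk h v n →
  Eval (D [ 1 ↦ lenClosure D ]) (emptyEnv [ 0 ↦ v ]) h lenBody (vint (+ n)) h
len-terminates walk-nil = e-matchN refl (e-basic e-const)
len-terminates (walk-cons {c = cell _ _} stored rest) =
  e-matchC refl stored (e-let (e-call refl refl refl (len-terminates rest))
    (e-let e-const (e-basic (e-op refl refl (cong just (succ-ℤ _))))))

-- aux(x, y, p, n, a, b) =                                         (function 2)
--   if y − p = 0 then a else if y − n = 0 then b
--   else aux(x, y, p + 1, n − 1, a + x, b − x)

auxParams : List Var
auxParams = 0 ∷ 1 ∷ 2 ∷ 3 ∷ 4 ∷ 5 ∷ []

auxRecurse : Expr
auxRecurse = elet 9 (bconst (+ 1)) (elet 10 (bop plus 2 9) (elet 11 (bop minus 3 9)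
  (elet 12 (bop plus 4 0) (elet 13 (bop minus 5 0)
  (basic (bcall 2 (0 ∷ 1 ∷ 10 ∷ 11 ∷ 12 ∷ 13 ∷ [])))))))

auxBody : Expr
auxBody = elet 6 (bconst (+ 0)) (elet 7 (bop minus 1 2)
  (eif 7 (elet 8 (bop minus 1 3) (eif 8 auxRecurse (basic (bop plus 5 6))))
         (basic (bop plus 4 6))))

auxClosure : FunEnv → Closure
auxClosure D = clo 2 auxParams auxBody D

auxEnv : (x y p n a b : ℤ) → Env
auxEnv x y p n a b = (((((emptyEnv [ 5 ↦ vint b ]) [ 4 ↦ vint a ]) [ 3 ↦ vint n ])
  [ 2 ↦ vint p ]) [ 1 ↦ vint y ]) [ 0 ↦ vint x ]

record Counters (x : ℤ) (t : ℕ) (p n a b : ℤ) : Set where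
  constructor counters
  field
    up   : p ≡ + t
    down : n ≡ ℤ.- + t
    acc⁺ : a ≡ x ℤ.* + t
    acc⁻ : b ≡ ℤ.- (x ℤ.* + t)

counters-start : ∀ x → Counters x 0 (+ 0) (+ 0) (+ 0) (+ 0)
counters-start x = counters refl refl (sym (ℤP.*-zeroʳ x)) (sym (cong ℤ.-_ (ℤP.*-zeroʳ x)))

counters-step : ∀ {x t p n a b} → Counters x t p n a b →
  Counters x (suc t) (p ℤ.+ + 1) (n ℤ.- + 1) (a ℤ.+ x) (b ℤ.- x)
counters-step {x} {t} (counters refl refl refl refl) =
  counters (succ-ℤ t) (down-step (+ t)) (acc⁺-step x (+ t)) (acc⁻-step x (+ t))
  where
  down-step : ∀ (T : ℤ) → ℤ.- T ℤ.- + 1 ≡ ℤ.- (+ 1 ℤ.+ T)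
  down-step = solve-∀
  acc⁺-step : ∀ (x T : ℤ) → x ℤ.* T ℤ.+ x ≡ x ℤ.* (+ 1 ℤ.+ T)
  acc⁺-step = solve-∀
  acc⁻-step : ∀ (x T : ℤ) → ℤ.- (x ℤ.* T) ℤ.- x ≡ ℤ.- (x ℤ.* (+ 1 ℤ.+ T))
  acc⁻-step = solve-∀

counters-hit⁺ : ∀ {x y t p n a b} → Counters x t p n a b → y ℤ.- p ≡ + 0 → a ℤ.+ + 0 ≡ x ℤ.* y
counters-hit⁺ {x} {y} (counters refl _ refl _) y-p≡0 =
  trans (ℤP.+-identityʳ _) (cong (x ℤ.*_) (sym (ℤP.i-j≡0⇒i≡j y _ y-p≡0)))

counters-hit⁻ : ∀ {x y t p n a b} → Counters x t p n a b → y ℤ.- n ≡ + 0 → b ℤ.+ + 0 ≡ x ℤ.* y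
counters-hit⁻ {x} {y} {t} (counters _ refl _ refl) y-n≡0 = begin
  ℤ.- (x ℤ.* + t) ℤ.+ + 0 ≡⟨ ℤP.+-identityʳ _ ⟩
  ℤ.- (x ℤ.* + t)         ≡⟨ ℤP.neg-distribʳ-* x (+ t) ⟩
  x ℤ.* ℤ.- + t           ≡⟨ cong (x ℤ.*_) (sym (ℤP.i-j≡0⇒i≡j y _ y-n≡0)) ⟩
  x ℤ.* y                 ∎
  where open ≡-Reasoning

counters-meet : ∀ {x y t p n a b} → Counters x t p n a b → t ≡ ∣ y ∣ →
  y ℤ.- p ≡ + 0 ⊎ y ℤ.- n ≡ + 0
counters-meet {y = + m}     (counters refl _ _ _) refl = inj₁ (ℤP.+-inverseʳ (+ m))
counters-meet {y = -[1+ m ]} (counters _ refl _ _) refl = inj₂ (ℤP.+-inverseʳ -[1+ m ])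

aux-correct : ∀ {D h x y t p n a b r h′} → Counters x t p n a b →
  Eval (D [ 2 ↦ auxClosure D ]) (auxEnv x y p n a b) h auxBody r h′ → r ≡ vint (x ℤ.* y) × h′ ≡ h
aux-correct inv (e-let e-const (e-let (e-op refl refl refl) (e-ifF y-p≡0
  (e-basic (e-op refl refl refl))))) =
  cong vint (counters-hit⁺ inv (vint-injective y-p≡0)) , refl
aux-correct inv (e-let e-const (e-let (e-op refl refl refl) (e-ifT refl _
  (e-let (e-op refl refl refl) (e-ifF y-n≡0 (e-basic (e-op refl refl refl))))))) =
  cong vint (counters-hit⁻ inv (vint-injective y-n≡0)) , refl
aux-correct inv (e-let e-const (e-let (e-op refl refl refl) (e-ifT refl _
  (e-let (e-op refl refl refl) (e-ifT refl _ (e-let e-const (e-let (e-op refl refl refl)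
  (e-let (e-op refl refl refl) (e-let (e-op refl refl refl) (e-let (e-op refl refl refl)
  (e-basic (e-call refl refl refl run)))))))))))) =
  aux-correct (counters-step inv) run

-- Termination by the number d of iterations left before the search meets y.
aux-terminates : ∀ {D h x y t p n a b} (d : ℕ) → t ℕ.+ d ≡ ∣ y ∣ → Counters x t p n a b →
  Eval (D [ 2 ↦ auxClosure D ]) (auxEnv x y p n a b) h auxBody (vint (x ℤ.* y)) h
aux-terminates {D} {h} {x} {y} {t} {p} {n} {a} {b} d t+d≡∣y∣ inv with (y ℤ.- p) ℤ.≟ + 0
... | yes y-p≡0 = e-let e-const (e-let (e-op refl refl refl)
  (e-ifF (cong (λ i → just (vint i)) y-p≡0) (e-basic (e-op refl refl (cong just (counters-hit⁺ inv y-p≡0))))))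
... | no y-p≢0 with (y ℤ.- n) ℤ.≟ + 0
...   | yes y-n≡0 = e-let e-const (e-let (e-op refl refl refl) (e-ifT refl y-p≢0
  (e-let (e-op refl refl refl) (e-ifF (cong (λ i → just (vint i)) y-n≡0)
  (e-basic (e-op refl refl (cong just (counters-hit⁻ inv y-n≡0))))))))
...   | no y-n≢0 = e-let e-const (e-let (e-op refl refl refl) (e-ifT refl y-p≢0
  (e-let (e-op refl refl refl) (e-ifT refl y-n≢0 (recurse d t+d≡∣y∣)))))
  where
  afterTests : Env
  afterTests = ((auxEnv x y p n a b [ 6 ↦ vint (+ 0) ]) [ 7 ↦ vint (y ℤ.- p) ]) [ 8 ↦ vint (y ℤ.- n) ]
  recurse : ∀ d → t ℕ.+ d ≡ ∣ y ∣ →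
    Eval (D [ 2 ↦ auxClosure D ]) afterTests h auxRecurse (vint (x ℤ.* y)) h
  recurse zero t≡∣y∣ =
    ⊥-elim ([ y-p≢0 , y-n≢0 ]′ (counters-meet {y = y} inv (trans (sym (ℕP.+-identityʳ t)) t≡∣y∣)))
  recurse (suc d) t+d≡∣y∣ = e-let e-const (e-let (e-op refl refl refl)
    (e-let (e-op refl refl refl) (e-let (e-op refl refl refl) (e-let (e-op refl refl refl)
    (e-basic (e-call refl refl refl
      (aux-terminates d (trans (sym (ℕP.+-suc t d)) t+d≡∣y∣) (counters-step inv))))))))

-- mul(x, y) = aux(x, y, 0, 0, 0, 0)                               (function 3)

mulBody : Expr
mulBody = elet 2 (bconst (+ 0)) (basic (bcall 2 (0 ∷ 1 ∷ 2 ∷ 2 ∷ 2 ∷ 2 ∷ [])))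

mulClosure : FunEnv → Closure
mulClosure D = clo 3 (0 ∷ 1 ∷ []) mulBody D

mul-call-correct : ∀ {F D DA E h z₁ z₂ x y r h′} → F 3 ≡ just (mulClosure D) →
  D 2 ≡ just (auxClosure DA) → E z₁ ≡ just (vint x) → E z₂ ≡ just (vint y) →
  EvalB F E h (bcall 3 (z₁ ∷ z₂ ∷ [])) r h′ → r ≡ vint (x ℤ.* y) × h′ ≡ h
mul-call-correct {E = E} {z₁ = z₁} {z₂} isMul isAux found₁ found₂ run
  with call-inv isMul (lookup-two E z₁ z₂ found₁ found₂) refl run
... | e-let e-const (e-basic loop) = aux-correct (counters-start _) (call-inv isAux refl refl loop)

mul-call-terminates : ∀ {F D DA E h z₁ z₂ x y} → F 3 ≡ just (mulClosure D) →
  D 2 ≡ just (auxClosure DA) → E z₁ ≡ just (vint x) → E z₂ ≡ just (vint y) →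
  EvalB F E h (bcall 3 (z₁ ∷ z₂ ∷ [])) (vint (x ℤ.* y)) h
mul-call-terminates {E = E} {z₁ = z₁} {z₂} {x} {y} isMul isAux found₁ found₂ =
  e-call isMul (lookup-two E z₁ z₂ found₁ found₂) refl (e-let e-const (e-basic
    (e-call isAux refl refl (aux-terminates ∣ y ∣ refl (counters-start x)))))

-- build(w) = if w then cons(w, build(w − 1)) else nil              (function 4)

buildBody : Expr
buildBody = eif 0 (elet 1 (bconst (+ 1)) (elet 2 (bop minus 0 1) (elet 3 (bcall 4 (2 ∷ []))
  (basic (bcons 0 3))))) (basic bnil)

buildClosure : FunEnv → Closure
buildClosure D = clo 4 (0 ∷ []) buildBody D

build-correct : ∀ {D h w r h′} (n : ℕ) → w ≡ + n →
  Eval (D [ 4 ↦ buildClosure D ]) (emptyEnv [ 0 ↦ vint w ]) h buildBody r h′ → Represents h′ r n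
build-correct n w≡n (e-ifF w≡0 (e-basic e-nil)) with trans (sym w≡n) (vint-injective w≡0)
... | refl = rep-nil
build-correct zero    w≡0 (e-ifT refl w≢0 _) = ⊥-elim (w≢0 w≡0)
build-correct (suc n) refl (e-ifT refl _ (e-let e-const (e-let (e-op refl refl refl)
  (e-let (e-call refl refl refl run) (e-basic (e-cons ℓ refl refl fresh)))))) =
  represents-push _ fresh (build-correct n refl run)

-- build allocates each cell just above the current bound of the finite heap.
build-terminates : ∀ {D h} (n : ℕ) {w} → w ≡ + n → FiniteHeap h → Σ Val λ r → Σ Heap λ h′ →
  FiniteHeap h′ × Eval (D [ 4 ↦ buildClosure D ]) (emptyEnv [ 0 ↦ vint w ]) h buildBody r h′
build-terminates zero w≡0 finite =
  vnull , _ , finite , e-ifF (cong (λ i → just (vint i)) w≡0) (e-basic e-nil)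
build-terminates {D} {h} (suc n) refl finite with build-terminates {D} {h} n {+ n} refl finite
... | r , h₁ , (b , above) , run =
  vloc b , h₁ [ b ↦ cell (vint (+ suc n)) r ] , allocate-finite h₁ b _ above ,
  e-ifT refl (λ ()) (e-let e-const (e-let (e-op refl refl refl)
    (e-let (e-call refl refl refl run) (e-basic (e-cons b refl refl (above b ℕP.≤-refl))))))

squareAndBuild : ℕ → Expr
squareAndBuild k = elet (suc k) (bcall 3 (k ∷ k ∷ [])) (basic (bcall 4 (suc k ∷ [])))

square-nonneg : ∀ c → c ℤ.* c ≡ + ∣ c ℤ.* c ∣
square-nonneg (+ zero)  = refl
square-nonneg (+ suc _) = refl
square-nonneg -[1+ _ ] = refl

squareAndBuild-correct : ∀ {F DM DA DB E h k c v h′} → F 3 ≡ just (mulClosure DM) →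
  DM 2 ≡ just (auxClosure DA) → F 4 ≡ just (buildClosure DB) → E k ≡ just (vint c) →
  Eval F E h (squareAndBuild k) v h′ → Represents h′ v ∣ c ℤ.* c ∣
squareAndBuild-correct {E = E} {k = k} {c} isMul isAux isBuild found (e-let square (e-basic build))
  with mul-call-correct isMul isAux found found square
... | refl , refl = build-correct _ (square-nonneg c)
  (call-inv isBuild (lookup-one (E [ suc k ↦ vint (c ℤ.* c) ]) (suc k) (update-same E (suc k) _)) refl build)

squareAndBuild-terminates : ∀ {F DM DA DB E h k c} → F 3 ≡ just (mulClosure DM) →
  DM 2 ≡ just (auxClosure DA) → F 4 ≡ just (buildClosure DB) → E k ≡ just (vint c) →
  FiniteHeap h → ∃₂ λ v h′ → Eval F E h (squareAndBuild k) v h′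
squareAndBuild-terminates {DB = DB} {E} {h} {k} {c} isMul isAux isBuild found finite
  with build-terminates {DB} {h} ∣ c ℤ.* c ∣ (square-nonneg c) finite
... | v , h′ , _ , build = v , h′ , e-let (mul-call-terminates isMul isAux found found)
  (e-basic (e-call isBuild (lookup-one (E [ suc k ↦ vint (c ℤ.* c) ]) (suc k) (update-same E (suc k) _)) refl build))

-- comp q m K evaluates q into variable m, using the variables above m as
-- scratch space, and then continues with K.
comp : ∀ {k} → Poly k → ℕ → Expr → Expr
comp (pconst c) m K = elet m (bconst c) K
comp (pvar i)   m K = elet m (bcall 1 (toℕ i ∷ [])) K
comp (padd p q) m K =
  comp p (suc m) (comp q (suc (suc m)) (elet m (bop plus (suc m) (suc (suc m))) K))
comp (pmul p q) m K =
  comp p (suc m) (comp q (suc (suc m)) (elet m (bcall 3 (suc m ∷ suc (suc m) ∷ [])) K))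

result  : ∀ {k} → Poly k → Vec ℕ k → ℕ → Env → Env
scratch : ∀ {k} → Poly k → Vec ℕ k → ℕ → Env → Env

result q ns m E = scratch q ns m E [ m ↦ vint (⟦ q ⟧ ns) ]

scratch (pconst _) ns m E = E
scratch (pvar _)   ns m E = E
scratch (padd p q) ns m E = result q ns (suc (suc m)) (result p ns (suc m) E)
scratch (pmul p q) ns m E = result q ns (suc (suc m)) (result p ns (suc m) E)

result-value : ∀ {k} (q : Poly k) ns m E → result q ns m E m ≡ just (vint (⟦ q ⟧ ns))
result-value q ns m E = update-same (scratch q ns m E) m _

result-below  : ∀ {k} (q : Poly k) ns m E {x} → x < m → result q ns m E x ≡ E x
scratch-below : ∀ {k} (q : Poly k) ns m E {x} → x < m → scratch q ns m E x ≡ E x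

result-below q ns m E x<m =
  trans (update-other _ _ (λ m≡x → ℕP.<-irrefl (sym m≡x) x<m)) (scratch-below q ns m E x<m)

scratch-below (pconst _) ns m E x<m = refl
scratch-below (pvar _)   ns m E x<m = refl
scratch-below (padd p q) ns m E x<m =
  trans (result-below q ns _ _ (ℕP.m<n⇒m<1+n (ℕP.m<n⇒m<1+n x<m))) (result-below p ns _ E (ℕP.m<n⇒m<1+n x<m))
scratch-below (pmul p q) ns m E x<m =
  trans (result-below q ns _ _ (ℕP.m<n⇒m<1+n (ℕP.m<n⇒m<1+n x<m))) (result-below p ns _ E (ℕP.m<n⇒m<1+n x<m))

operand₁ : ∀ {k} (p q : Poly k) ns m E →
  result q ns (suc (suc m)) (result p ns (suc m) E) (suc m) ≡ just (vint (⟦ p ⟧ ns))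
operand₁ p q ns m E = trans (result-below q ns _ _ (ℕP.n<1+n (suc m))) (result-value p ns (suc m) E)

operand₂ : ∀ {k} (p q : Poly k) ns m E →
  result q ns (suc (suc m)) (result p ns (suc m) E) (suc (suc m)) ≡ just (vint (⟦ q ⟧ ns))
operand₂ p q ns m E = result-value q ns (suc (suc m)) _

Binds : ∀ {k} → Vec Val k → Env → Set
Binds vs E = ∀ i → E (toℕ i) ≡ just (Vec.lookup vs i)

binds-result : ∀ {k} (q : Poly k) ns {m E} {vs : Vec Val k} → k ≤ m → Binds vs E →
  Binds vs (result q ns m E)
binds-result q ns k≤m binds i = trans (result-below q ns _ _ (ℕP.<-≤-trans (toℕ<n i) k≤m)) (binds i)

module Compiled {F DL DM DA : FunEnv} (isLen : F 1 ≡ just (lenClosure DL))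
  (isMul : F 3 ≡ just (mulClosure DM)) (isAux : DM 2 ≡ just (auxClosure DA))
  {k : ℕ} {h : Heap} (vs : Vec Val k) (ns : Vec ℕ k)
  (walks : ∀ i → Walk h (Vec.lookup vs i) (Vec.lookup ns i)) where

  -- the scratch variables of subterms lie above m, hence above the parameters
  widen : ∀ {m} → k ≤ m → k ≤ suc m
  widen = ℕP.m≤n⇒m≤1+n

  comp-correct : ∀ (q : Poly k) m K {E v h′} → k ≤ m → Binds vs E →
    Eval F E h (comp q m K) v h′ → Eval F (result q ns m E) h K v h′
  comp-correct (pconst c) m K k≤m binds (e-let e-const run) = run
  comp-correct (pvar i) m K {E} k≤m binds (e-let len run)
    with len-correct (walks i) (call-inv isLen (lookup-one E (toℕ i) (binds i)) refl len)
  ... | refl , refl = run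
  comp-correct (padd p q) m K {E} k≤m binds run
    with comp-correct q _ _ (widen (widen k≤m)) (binds-result p ns {vs = vs} (widen k≤m) binds)
           (comp-correct p _ _ (widen k≤m) binds run)
  ... | e-let (e-op found₁ found₂ refl) run′
    with vint-injective (trans (sym (operand₁ p q ns m E)) found₁)
       | vint-injective (trans (sym (operand₂ p q ns m E)) found₂)
  ... | refl | refl = run′
  comp-correct (pmul p q) m K {E} k≤m binds run
    with comp-correct q _ _ (widen (widen k≤m)) (binds-result p ns {vs = vs} (widen k≤m) binds)
           (comp-correct p _ _ (widen k≤m) binds run)
  ... | e-let product run′ with mul-call-correct isMul isAux (operand₁ p q ns m E) (operand₂ p q ns m E) product
  ... | refl , refl = run′

  comp-complete : ∀ (q : Poly k) m K {E v h′} → k ≤ m → Binds vs E →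
    Eval F (result q ns m E) h K v h′ → Eval F E h (comp q m K) v h′
  comp-complete (pconst c) m K k≤m binds run = e-let e-const run
  comp-complete (pvar i) m K {E} k≤m binds run =
    e-let (e-call isLen (lookup-one E (toℕ i) (binds i)) refl (len-terminates (walks i))) run
  comp-complete (padd p q) m K {E} k≤m binds run =
    comp-complete p _ _ (widen k≤m) binds
      (comp-complete q _ _ (widen (widen k≤m)) (binds-result p ns {vs = vs} (widen k≤m) binds)
        (e-let (e-op (operand₁ p q ns m E) (operand₂ p q ns m E) refl) run))
  comp-complete (pmul p q) m K {E} k≤m binds run =
    comp-complete p _ _ (widen k≤m) binds
      (comp-complete q _ _ (widen (widen k≤m)) (binds-result p ns {vs = vs} (widen k≤m) binds)
        (e-let (mul-call-terminates isMul isAux (operand₁ p q ns m E) (operand₂ p q ns m E)) run))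

wf-weaken-basic : ∀ {S S′} → S ⊆ S′ → ∀ b → WFB S b → WFB S′ b
wf-weaken-basic S⊆S′ (bconst _)   _         = tt
wf-weaken-basic S⊆S′ (bop _ x y)  (x∈ , y∈) = S⊆S′ x∈ , S⊆S′ y∈
wf-weaken-basic S⊆S′ bnil         _         = tt
wf-weaken-basic S⊆S′ (bcons z l)  (z∈ , l∈) = S⊆S′ z∈ , S⊆S′ l∈
wf-weaken-basic S⊆S′ (bcall _ zs) zs∈       = All.map S⊆S′ zs∈

wf-weaken : ∀ {S S′} → S ⊆ S′ → ∀ e → WF S e → WF S′ e
wf-weaken S⊆S′ (basic b) wb = wf-weaken-basic S⊆S′ b wb
wf-weaken S⊆S′ (elet z b e) (wb , we) = wf-weaken-basic S⊆S′ b wb , wf-weaken (∷⁺ʳ z S⊆S′) e we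
wf-weaken S⊆S′ (eif x e₁ e₂) (x∈ , w₁ , w₂) = S⊆S′ x∈ , wf-weaken S⊆S′ e₁ w₁ , wf-weaken S⊆S′ e₂ w₂
wf-weaken S⊆S′ (ematch l e₁ hd tl e₂) (l∈ , w₁ , w₂) =
  S⊆S′ l∈ , wf-weaken S⊆S′ e₁ w₁ , wf-weaken (∷⁺ʳ hd (∷⁺ʳ tl S⊆S′)) e₂ w₂
wf-weaken S⊆S′ (eletfun f ps e₁ e₂) (w₁ , w₂) = w₁ , wf-weaken S⊆S′ e₂ w₂

scratch-scope : ∀ m S → m ∷ S ⊆ m ∷ suc (suc m) ∷ suc m ∷ S
scratch-scope m S = ∷⁺ʳ m (λ x∈S → there (there x∈S))

comp-wf : ∀ {k} (q : Poly k) m S K → (∀ (i : Fin k) → toℕ i ∈ S) → WF (m ∷ S) K →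
  WF S (comp q m K)
comp-wf (pconst c) m S K params∈ wK = tt , wK
comp-wf (pvar i)   m S K params∈ wK = (params∈ i ∷ []) , wK
comp-wf (padd p q) m S K params∈ wK =
  comp-wf p (suc m) S _ params∈ (comp-wf q (suc (suc m)) (suc m ∷ S) _ (λ i → there (params∈ i))
    ((there (here refl) , here refl) , wf-weaken (scratch-scope m S) K wK))
comp-wf (pmul p q) m S K params∈ wK =
  comp-wf p (suc m) S _ params∈ (comp-wf q (suc (suc m)) (suc m ∷ S) _ (λ i → there (params∈ i))
    ((there (here refl) ∷ here refl ∷ []) , wf-weaken (scratch-scope m S) K wK))

-- Well-formedness is decidable; it is checked by evaluation for the fixed
-- helper bodies.
wf-basic? : ∀ S b → Dec (WFB S b)
wf-basic? S (bconst _)   = yes tt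
wf-basic? S (bop _ x y)  = (x ∈? S) ×-dec (y ∈? S)
wf-basic? S bnil         = yes tt
wf-basic? S (bcons z l)  = (z ∈? S) ×-dec (l ∈? S)
wf-basic? S (bcall _ zs) = all? (_∈? S) zs

wf? : ∀ S e → Dec (WF S e)
wf? S (basic b)              = wf-basic? S b
wf? S (elet z b e)           = wf-basic? S b ×-dec wf? (z ∷ S) e
wf? S (eif x e₁ e₂)          = (x ∈? S) ×-dec wf? S e₁ ×-dec wf? S e₂
wf? S (ematch l e₁ hd tl e₂) = (l ∈? S) ×-dec wf? S e₁ ×-dec wf? (hd ∷ tl ∷ S) e₂
wf? S (eletfun f ps e₁ e₂)   = wf? ps e₁ ×-dec wf? S e₂

consecutive : ℕ → (k : ℕ) → Vec Var k
consecutive s zero    = []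
consecutive s (suc k) = s ∷ consecutive (suc s) k

bind-consecutive : ∀ s {k} (vs : Vec Val k) i →
  bindVec (consecutive s k) vs (s ℕ.+ toℕ i) ≡ just (Vec.lookup vs i)
bind-consecutive s (v ∷ vs) Fin.zero rewrite ℕP.+-identityʳ s = update-same _ s v
bind-consecutive s (v ∷ vs) (Fin.suc i) rewrite ℕP.+-suc s (toℕ i) =
  trans (update-other _ v (λ s≡ → ℕP.<-irrefl s≡ (s≤s (ℕP.m≤m+n s (toℕ i)))))
        (bind-consecutive (suc s) vs i)

consecutive-member : ∀ s {k} (i : Fin k) → s ℕ.+ toℕ i ∈ Vec.toList (consecutive s k)
consecutive-member s Fin.zero = here (ℕP.+-identityʳ s)
consecutive-member s {suc k} (Fin.suc i) =
  there (subst (_∈ Vec.toList (consecutive (suc s) k)) (sym (ℕP.+-suc s (toℕ i)))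
    (consecutive-member (suc s) i))

consecutive-above : ∀ t s k → t < s → All (t ≢_) (Vec.toList (consecutive s k))
consecutive-above t s zero    t<s = []
consecutive-above t s (suc k) t<s =
  (λ t≡s → ℕP.<-irrefl t≡s t<s) ∷ consecutive-above t (suc s) k (ℕP.m<n⇒m<1+n t<s)

consecutive-unique : ∀ s k → Unique (Vec.toList (consecutive s k))
consecutive-unique s zero    = []
consecutive-unique s (suc k) = consecutive-above s (suc s) k (ℕP.n<1+n s) ∷ consecutive-unique (suc s) k

mainBody : ∀ k → Poly k → Expr
mainBody k q = eletfun 1 (0 ∷ []) lenBody (eletfun 2 auxParams auxBody
  (eletfun 3 (0 ∷ 1 ∷ []) mulBody (eletfun 4 (0 ∷ []) buildBody (comp q k (squareAndBuild k)))))

witness : ∀ k → Poly k → FunDef k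
witness k q = fundef 0 (consecutive 0 k) (mainBody k q)

module Witness (k : ℕ) (q : Poly k) where

  F₀ F₁ F₂ F₃ F₄ : FunEnv
  F₀ = emptyFunEnv [ 0 ↦ clo 0 (Vec.toList (consecutive 0 k)) (mainBody k q) emptyFunEnv ]
  F₁ = F₀ [ 1 ↦ lenClosure F₀ ]
  F₂ = F₁ [ 2 ↦ auxClosure F₁ ]
  F₃ = F₂ [ 3 ↦ mulClosure F₂ ]
  F₄ = F₃ [ 4 ↦ buildClosure F₃ ]

  walks : ∀ {h} vs ns → ArgsRepresent {k} h vs ns → ∀ i → Walk h (Vec.lookup vs i) (Vec.lookup ns i)
  walks vs ns args i = represents⇒walk (λ _ found → found) (args i)

  well-formed : WellFormedDef (witness k q)
  well-formed = consecutive-unique 0 k ,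
    toWitness {a? = wf? (0 ∷ []) lenBody} tt ,
    toWitness {a? = wf? auxParams auxBody} tt ,
    toWitness {a? = wf? (0 ∷ 1 ∷ []) mulBody} tt ,
    toWitness {a? = wf? (0 ∷ []) buildBody} tt ,
    comp-wf q k _ (squareAndBuild k) (consecutive-member 0)
      ((here refl ∷ here refl ∷ []) , (here refl ∷ []))

  -- any run ends with build(q(ns)²), whose result has length q(ns)²
  shapely : ShapelyWith (witness k q) (sq q)
  shapely h _ vs ns args v h′ (e-letfun (e-letfun (e-letfun (e-letfun run)))) =
    squareAndBuild-correct refl refl refl (result-value q ns k _)
      (Compiled.comp-correct refl refl refl vs ns (walks vs ns args) q k _ ℕP.≤-refl (bind-consecutive 0 vs) run)

  -- a run of the tail lifts through comp and the four letfuns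
  total : Total (witness k q)
  total h finite vs ns args
    with squareAndBuild-terminates {F₄} refl refl refl (result-value q ns k (bindVec (consecutive 0 k) vs)) finite
  ... | v , h′ , run =
    v , h′ , e-letfun (e-letfun (e-letfun (e-letfun
      (Compiled.comp-complete refl refl refl vs ns (walks vs ns args) q k _ ℕP.≤-refl (bind-consecutive 0 vs) run))))

lemma4p1 : (k : ℕ) (q : Poly k) →
    Σ (FunDef k) λ f → WellFormedDef f × Total f × ShapelyWith f (sq q)
lemma4p1 k q = witness k q , Witness.well-formed k q , Witness.total k q , Witness.shapely k q
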